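{- $(\mathbb Q\mathcal S_c^{Ch},\sqcup\!\sqcup)$ is a locality subalgebra of $(\mathbb Q\mathcal S^{Ch},\sqcup\!\sqcup)$, and $(\mathbb Q\mathcal F_c^{Ch},\cdot)$ is a subalgebra of $(\mathbb Q\mathcal F^{Ch},\cdot)$. Here $\mathcal S_c^{Ch}$ consists of $\mathbf 1$ and the Chen symbols $\binom{s_1,\dots,s_m}{i_1,\dots,i_m}$ with $s_1+\cdots+s_j>j$ for all $1\le j\le m$. Likewise, $\mathcal F_c^{Ch}$ consists of $1$ and the generalized Chen fractions $f\binom{s_1,\dots,s_m}{x_{i_1},\dots,x_{i_m}}$ with $s_1+\cdots+s_j>j$ for all $1\le j\le m$. In particular, for $a,b\in\mathbb Q\mathcal S_c^{Ch}$ with $a\top b$ we have $a\sqcup\!\sqcup b\in\mathbb Q\mathcal S_c^{Ch}$. Also, products of elements of $\mathbb Q\mathcal F_c^{Ch}$ in disjoint sets of variables lie in $\mathbb Q\mathcal F_c^{Ch}$.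
   Context: Two-row algebra. Let $\mathcal H_{\mathbb Z\times\mathbb Z_{\ge1}}$ have basis $\mathbf 1$ together with the formal symbols $\binom{s_1,\dots,s_k}{u_1,\dots,u_k}$ ($k\ge1$, $s_i\in\mathbb Z$, $u_i\in\mathbb Z_{\ge1}$). $I^S$ and $J^S$ add $+1$ and $-1$ respectively to the top-left entry, with $J^S(\mathbf 1)=0$. Write basis elements as $\binom{s_1,\vec s\,'}{u_1,\vec u'}$, where the remaining columns are read as $\mathbf 1$ if empty. The product $\sqcup\!\sqcup$ is bilinear with unit $\mathbf 1$, and is defined by: <ul> <li>(i) if $s_1=0$: prepend the column $\binom0{u_1}$ to each term of $\binom{\vec s\,'}{\vec u'}\sqcup\!\sqcup\binom{t_1,\vec t\,'}{v_1,\vec v'}$;</li> <li>(ii) if $s_1>0$ and $t_1=0$: prepend the column $\binom0{v_1}$ to each term of $\binom{s_1,\vec s\,'}{u_1,\vec u'}\sqcup\!\sqcup\binom{\vec t\,'}{\vec v'}$;</li> <li>(iii) if $s_1,t_1>0$: the product equals $I^S(\binom{s_1,\vec s\,'}{u_1,\vec u'}\sqcup\!\sqcup\binom{t_1-1,\vec t\,'}{v_1,\vec v'})+I^S(\binom{s_1-1,\vec s\,'}{u_1,\vec u'}\sqcup\!\sqcup\binom{t_1,\vec t\,'}{v_1,\vec v'})$;</li> <li>(iv) if $s_1>0$ and $t_1<0$: the product equals $J^S(\binom{s_1,\vec s\,'}{u_1,\vec u'}\sqcup\!\sqcup\binom{t_1+1,\vec t\,'}{v_1,\vec v'})-\binom{s_1-1,\vec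 s\,'}{u_1,\vec u'}\sqcup\!\sqcup\binom{t_1+1,\vec t\,'}{v_1,\vec v'}$;</li> <li>(v) if $s_1<0$: the product equals $J^S(\binom{s_1+1,\vec s\,'}{u_1,\vec u'}\sqcup\!\sqcup\binom{t_1,\vec t\,'}{v_1,\vec v'})-\binom{s_1+1,\vec s\,'}{u_1,\vec u'}\sqcup\!\sqcup\binom{t_1-1,\vec t\,'}{v_1,\vec v'}$.</li> </ul> A Chen symbol is a basis element whose bottom entries are pairwise distinct. $\mathcal S^{Ch}$ is the set of Chen symbols together with $\mathbf 1$, and $\mathbb Q\mathcal S^{Ch}$ is its span. The locality relation $\top$ is given by: $\mathbf 1$ is related to everything, and two Chen symbols are related iff their bottom rows have no common entry. It is extended to spans via supports. A generalized Chen fraction is $f\binom{s_1,\dots,s_k}{x_{i_1},\dots,x_{i_k}}=\prod_{j=1}^k(x_{i_j}+\cdots+x_{i_k})^{ -s_j}$ for distinct $i_j\in\mathbb Z_{\ge1}$ and $s_j\in\mathbb Z$. $\mathbb Q\mathcal F^{Ch}$ is the span of all such fractions, with ordinary multiplication, and with locality relation "in disjoint sets of variables". A locality subalgebra is a subspace, with the restricted relation, that is closed under products of related pairs. -}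

module Defs where

open import Data.Nat as ℕ using (ℕ; zero; suc)
open import Data.Integer as ℤ using (ℤ; +_; -[1+_])
open import Data.Rational as ℚ using (ℚ; 0ℚ; 1ℚ)
open import Data.Rational.Properties as ℚP using ()
open import Data.List using (List; []; _∷_; map; foldr; take; length; _++_; concatMap)
open import Data.List.Properties as LP using ()
open import Data.Product using (_×_; _,_; proj₁; proj₂; Σ)
open import Data.Product.Properties as PP using ()
open import Data.Sum using (_⊎_)
open import Data.Empty using (⊥)
open import Data.Bool using (if_then_else_)
open import Data.List.Membership.Propositional using (_∈_)
open import Data.List.Relation.Unary.All using (All)
open import Data.List.Relation.Unary.Unique.Propositional using (Unique)
open import Relation.Nullary using (¬_; does; yes; no)
open import Relation.Binary.PropositionalEquality using (_≡_; _≢_)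
open import Relation.Binary.Definitions using (DecidableEquality)

-- A column (s , u) is the top entry s ∈ ℤ and bottom entry u.
-- A word [] is the unit 𝟏; (s₁,u₁) ∷ (s₂,u₂) ∷ … is the symbol
-- binom(s₁,s₂,… ; u₁,u₂,…).  Bottom entries are stored in ℕ; the
-- requirement u ≥ 1 is imposed in the Chen-symbol predicate (the product
-- never changes bottom entries).

Column : Set
Column = ℤ × ℕ

Word : Set
Word = List Column

_≟W_ : DecidableEquality Word
_≟W_ = LP.≡-dec (PP.≡-dec ℤ._≟_ ℕ._≟_)

-- Finite formal ℚ-linear combinations of words (a list of terms
-- coefficient · word; repeated words are added up, see coeff).
LC : Set
LC = List (ℚ × Word)

coeff : LC → Word → ℚ
coeff a w = foldr (λ t acc → if does (proj₂ t ≟W w) then proj₁ t ℚ.+ acc else acc) 0ℚ a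

InSpan : (Word → Set) → LC → Set
InSpan P a = ∀ w → coeff a w ≢ 0ℚ → P w

η : Word → LC
η w = (1ℚ , w) ∷ []

neg : LC → LC
neg = map (λ t → ℚ.- proj₁ t , proj₂ t)

_⊕_ : LC → LC → LC
a ⊕ b = a ++ b

_⊖_ : LC → LC → LC
a ⊖ b = a ++ neg b

pre : Column → LC → LC
pre c = map (λ t → proj₁ t , c ∷ proj₂ t)

-- I^S / J^S: add +1 / -1 to the top-left entry.  J^S(𝟏) = 0; I^S(𝟏) is
-- not specified in the paper and never occurs; we also set it to 0.
shiftW : ℤ → Word → LC
shiftW d [] = []
shiftW d ((s , u) ∷ w) = η ((s ℤ.+ d , u) ∷ w)

shift : ℤ → LC → LC
shift d = concatMap (λ t → map (λ t' → proj₁ t ℚ.* proj₁ t' , proj₂ t') (shiftW d (proj₂ t)))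

IS : LC → LC
IS = shift (+ 1)

JS : LC → LC
JS = shift ℤ.-1ℤ

-- A s u w v  =  binom(s,w ; u,…) ⧢ v.
-- Bpos a … = case s = + suc a;  Bneg n … = case s = -[1+ n];
-- B0 … = case s = +0;  Bsm a … = case s = + a (i.e. s-1 for s = + suc a).
-- In B*, the second word is (t , v) ∷ v'.

mutual
  _⧢_ : Word → Word → LC
  [] ⧢ v = η v
  ((s , u) ∷ w) ⧢ v = A s u w v

  A : ℤ → ℕ → Word → Word → LC
  A s u w [] = η ((s , u) ∷ w)
  A (+ zero) u w ((t , v) ∷ v') = B0 u w t v v'
  A (+ suc a) u w ((t , v) ∷ v') = Bpos a u w t v v'
  A -[1+ n ] u w ((t , v) ∷ v') = Bneg n u w t v v'

  B0 : ℕ → Word → ℤ → ℕ → Word → LC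
  B0 u w t v v' = pre (+ 0 , u) (w ⧢ ((t , v) ∷ v'))

  Bpos : ℕ → ℕ → Word → ℤ → ℕ → Word → LC
  Bpos a u w (+ zero) v v' = pre (+ 0 , v) (A (+ suc a) u w v')
  Bpos a u w (+ suc b) v v' = IS (Bpos a u w (+ b) v v') ⊕ IS (Bsm a u w (+ suc b) v v')
  -- rule (iv)  (t₁ + 1 = 0 resp. -[1+ n])
  Bpos a u w -[1+ zero ] v v' = JS (pre (+ 0 , v) (A (+ suc a) u w v')) ⊖ Bsm a u w (+ 0) v v'
  Bpos a u w -[1+ suc n ] v v' = JS (Bpos a u w -[1+ n ] v v') ⊖ Bsm a u w -[1+ n ] v v'

  Bsm : ℕ → ℕ → Word → ℤ → ℕ → Word → LC
  Bsm zero u w t v v' = B0 u w t v v'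
  Bsm (suc a) u w t v v' = Bpos a u w t v v'

  -- rule (v)  (s₁ + 1 = 0 resp. -[1+ n])
  Bneg : ℕ → ℕ → Word → ℤ → ℕ → Word → LC
  Bneg zero u w t v v' = JS (B0 u w t v v') ⊖ B0 u w (t ℤ.- + 1) v v'
  Bneg (suc n) u w t v v' = JS (Bneg n u w t v v') ⊖ Bneg n u w (t ℤ.- + 1) v v'

_⧢ᴸ_ : LC → LC → LC
a ⧢ᴸ b = concatMap (λ x → concatMap (λ y →
  map (λ t → proj₁ x ℚ.* proj₁ y ℚ.* proj₁ t , proj₂ t) (proj₂ x ⧢ proj₂ y)) b) a

tops : Word → List ℤ
tops = map proj₁

bottoms : Word → List ℕ
bottoms = map proj₂

sumℤ : List ℤ → ℤ
sumℤ = foldr ℤ._+_ (+ 0)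

-- bottom entries pairwise distinct (and ≥ 1); for fractions these are the
-- variable indices i_j
Chen : Word → Set
Chen w = Unique (bottoms w) × All (ℕ._≤_ 1) (bottoms w)

ConvTops : Word → Set
ConvTops w = ∀ j → 1 ℕ.≤ j → j ℕ.≤ length w → + j ℤ.< sumℤ (take j (tops w))

-- elements of S_c^Ch (and, read as fractions, of F_c^Ch)
Conv : Word → Set
Conv w = w ≡ [] ⊎ (Chen w × ConvTops w)

DisjointB : Word → Word → Set
DisjointB w w' = ∀ i → i ∈ bottoms w → i ∈ bottoms w' → ⊥

_⊤W_ : Word → Word → Set
w ⊤W w' = w ≡ [] ⊎ (w' ≡ [] ⊎ (Chen w × Chen w' × DisjointB w w'))

_⊤L_ : LC → LC → Set
a ⊤L b = ∀ w w' → coeff a w ≢ 0ℚ → coeff b w' ≢ 0ℚ → w ⊤W w'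

-- Generalized Chen fractions, evaluated at points x : ℕ → ℚ
-- (x i is the value of the variable x_i).

-- total reciprocal (only ever applied to positive numbers below)
inv : ℚ → ℚ
inv q with q ℚP.≟ 0ℚ
... | yes _ = 0ℚ
... | no q≢0 = ℚ.1/_ q {{ℚ.≢-nonZero q≢0}}

powℕ : ℚ → ℕ → ℚ
powℕ q zero = 1ℚ
powℕ q (suc n) = q ℚ.* powℕ q n

powNeg : ℚ → ℤ → ℚ
powNeg q (+ n) = powℕ (inv q) n
powNeg q -[1+ n ] = powℕ q (suc n)

sumVars : (ℕ → ℚ) → Word → ℚ
sumVars x w = foldr (λ c acc → x (proj₂ c) ℚ.+ acc) 0ℚ w

-- f(s₁,…,s_k ; x_{i₁},…,x_{i_k}) = ∏_j (x_{i_j}+⋯+x_{i_k})^{-s_j}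
frac : Word → (ℕ → ℚ) → ℚ
frac [] x = 1ℚ
frac ((s , i) ∷ w) x = powNeg (sumVars x ((s , i) ∷ w)) s ℚ.* frac w x

evalF : LC → (ℕ → ℚ) → ℚ
evalF a x = foldr (λ t acc → proj₁ t ℚ.* frac (proj₂ t) x ℚ.+ acc) 0ℚ a

-- points with all variables positive (where all fractions are defined)
Pos : (ℕ → ℚ) → Set
Pos x = ∀ i → 0ℚ ℚ.< x i

DependsOnly : ((ℕ → ℚ) → ℚ) → List ℕ → Set
DependsOnly F V = ∀ x y → Pos x → Pos y → (∀ i → i ∈ V → x i ≡ y i) → F x ≡ F y

DisjointL : List ℕ → List ℕ → Set
DisjointL V W = ∀ i → i ∈ V → i ∈ W → ⊥

{-# OPTIONS --safe #-}
module Submission where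

-- Both parts rest on an induction that follows the rules (i)–(v) defining ⧢.
-- Every term r of X ⧢ Y has as bottom row a permutation of the bottom rows of X and Y, so
-- a product of Chen symbols with disjoint bottom rows is a combination of Chen symbols.
-- For the top rows, the condition s₁ + ⋯ + s_j > j on r is the case δ = 0 of an invariant
-- of the pair (X , Y): any p leading columns of X together with any q leading columns of Y,
-- (p , q) ≠ (0 , 0), have top-row sum greater than p + q − δ.  Each rule preserves it once
-- δ absorbs the shift I^S or J^S, or the leading zero column, of the rule.  On spans, a word
-- in the support of a ⧢ b lies in the support of some X ⧢ Y with X, Y in the supports of a, b.
-- At points with positive coordinates X ⧢ Y evaluates to f(X) f(Y); for rule (iii) this is
-- the partial-fraction identity 1/(A+B) · (1/A + 1/B) = 1/(AB).  So for fractions it suffices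
-- to relabel the variables of a and b apart, keeping those in V and W: this changes neither
-- value and makes the symbols local.

open import Defs
open import Data.Bool using (if_then_else_)
open import Data.Empty using (⊥-elim)
open import Data.Integer as ℤ using (ℤ; +_; -[1+_])
import Data.Integer.Properties as ℤP
open import Data.Integer.Tactic.RingSolver using () renaming (solve-∀ to ℤ-solve-∀)
open import Data.List using (List; []; _∷_; _++_; map; foldr; concatMap; length; take)
import Data.List.Properties as LP
open import Data.List.Membership.Propositional using (_∈_; _∉_)
import Data.List.Membership.Propositional.Properties as MemP
open import Data.List.Relation.Binary.Permutation.Propositional
  using (_↭_; ↭-refl; ↭-reflexive; ↭-sym; ↭-trans; prep; ↭⇒↭ₛ)
import Data.List.Relation.Binary.Permutation.Propositional.Properties as PermP
import Data.List.Relation.Binary.Permutation.Setoid.Properties as PermSetoidP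
open import Data.List.Relation.Unary.All as All using (All; []; _∷_)
import Data.List.Relation.Unary.All.Properties as AllP
open import Data.List.Relation.Unary.Any using (here; there)
open import Data.List.Relation.Unary.Unique.Propositional using (Unique)
import Data.List.Relation.Unary.Unique.Propositional.Properties as UniqueP
open import Data.Nat as ℕ using (ℕ; zero; suc)
open import Data.Nat.ListAction using (sum)
import Data.Nat.Properties as ℕP
open import Data.Product using (_×_; _,_; proj₁; proj₂; Σ; ∃; ∃₂)
open import Data.Rational as ℚ using (ℚ; 0ℚ; 1ℚ; _+_; _*_; -_; _-_)
import Data.Rational.Properties as ℚP
open import Data.Sum using (inj₁; inj₂)
open import Function using (_∘_; id)
open import Level using (0ℓ)
open import Relation.Binary.PropositionalEquality
open import Relation.Nullary using (does; yes; no)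
open import Relation.Nullary.Decidable using (dec⇒maybe)
import Tactic.RingSolver as RingSolver
import Tactic.RingSolver.Core.AlmostCommutativeRing as ACR

open import Data.List.Membership.DecPropositional ℕ._≟_ using (_∈?_)

ℚ-ring : ACR.AlmostCommutativeRing 0ℓ 0ℓ
ℚ-ring = ACR.fromCommutativeRing ℚP.+-*-commutativeRing (λ q → dec⇒maybe (0ℚ ℚP.≟ q))

linExt : (Word → ℚ) → LC → ℚ
linExt G = foldr (λ t acc → proj₁ t * G (proj₂ t) + acc) 0ℚ

AllW : (Word → Set) → LC → Set
AllW P = All (P ∘ proj₂)

mapW : (Word → Word) → LC → LC
mapW f = map (λ t → proj₁ t , f (proj₂ t))

scale : ℚ → LC → LC
scale k = map (λ t → k * proj₁ t , proj₂ t)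

module _ (G : Word → ℚ) where

  linExt-++ : ∀ a b → linExt G (a ++ b) ≡ linExt G a + linExt G b
  linExt-++ [] b = sym (ℚP.+-identityˡ _)
  linExt-++ ((c , w) ∷ a) b =
    trans (cong (_+_ (c * G w)) (linExt-++ a b)) (sym (ℚP.+-assoc (c * G w) (linExt G a) (linExt G b)))

  linExt-neg : ∀ a → linExt G (neg a) ≡ - linExt G a
  linExt-neg [] = refl
  linExt-neg ((c , w) ∷ a) = trans (cong (_+_ ((- c) * G w)) (linExt-neg a)) (lemma c (G w) (linExt G a))
    where lemma : ∀ c g s → (- c) * g + (- s) ≡ - (c * g + s)
          lemma = RingSolver.solve-∀ ℚ-ring

  linExt-⊖ : ∀ a b → linExt G (a ⊖ b) ≡ linExt G a - linExt G b
  linExt-⊖ a b = trans (linExt-++ a (neg b)) (cong (_+_ (linExt G a)) (linExt-neg b))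

  linExt-scale : ∀ k a → linExt G (scale k a) ≡ k * linExt G a
  linExt-scale k [] = sym (ℚP.*-zeroʳ k)
  linExt-scale k ((c , w) ∷ a) =
    trans (cong (_+_ (k * c * G w)) (linExt-scale k a)) (lemma k c (G w) (linExt G a))
    where lemma : ∀ k c g s → k * c * g + k * s ≡ k * (c * g + s)
          lemma = RingSolver.solve-∀ ℚ-ring

  linExt-mapW : ∀ f a → linExt G (mapW f a) ≡ linExt (G ∘ f) a
  linExt-mapW f [] = refl
  linExt-mapW f ((c , w) ∷ a) = cong (_+_ (c * G (f w))) (linExt-mapW f a)

linExt-cong : ∀ {G H} a → AllW (λ w → G w ≡ H w) a → linExt G a ≡ linExt H a
linExt-cong [] [] = refl
linExt-cong ((c , w) ∷ a) (e ∷ es) = cong₂ (λ g s → c * g + s) e (linExt-cong a es)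

linExt-cong-∀ : ∀ {G H} → (∀ w → G w ≡ H w) → ∀ a → linExt G a ≡ linExt H a
linExt-cong-∀ e a = linExt-cong a (All.universal (e ∘ proj₂) a)

linExt-*ˡ : ∀ k G a → linExt (λ w → k * G w) a ≡ k * linExt G a
linExt-*ˡ k G [] = sym (ℚP.*-zeroʳ k)
linExt-*ˡ k G ((c , w) ∷ a) =
  trans (cong (_+_ (c * (k * G w))) (linExt-*ˡ k G a)) (lemma k c (G w) (linExt G a))
  where lemma : ∀ k c g s → c * (k * g) + k * s ≡ k * (c * g + s)
        lemma = RingSolver.solve-∀ ℚ-ring

linExt-*ʳ : ∀ k G a → linExt (λ w → G w * k) a ≡ linExt G a * k
linExt-*ʳ k G a = begin
  linExt (λ w → G w * k) a  ≡⟨ linExt-cong-∀ (λ w → ℚP.*-comm (G w) k) a ⟩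
  linExt (λ w → k * G w) a  ≡⟨ linExt-*ˡ k G a ⟩
  k * linExt G a            ≡⟨ ℚP.*-comm k _ ⟩
  linExt G a * k            ∎
  where open ≡-Reasoning

linExt-concatMap : ∀ G H (h : ℚ × Word → LC) a → (∀ t → linExt G (h t) ≡ proj₁ t * H (proj₂ t))
                 → linExt G (concatMap h a) ≡ linExt H a
linExt-concatMap G H h [] _ = refl
linExt-concatMap G H h (t ∷ a) e =
  trans (linExt-++ G (h t) (concatMap h a)) (cong₂ _+_ (e t) (linExt-concatMap G H h a e))

linExt-shift : ∀ G d a → linExt G (shift d a) ≡ linExt (linExt G ∘ shiftW d) a
linExt-shift G d a = linExt-concatMap G _ _ a (λ { (c , w) → linExt-scale G c (shiftW d w) })

linExt-⧢ᴸ : ∀ G a b → linExt G (a ⧢ᴸ b) ≡ linExt (λ X → linExt (λ Y → linExt G (X ⧢ Y)) b) a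
linExt-⧢ᴸ G a b = linExt-concatMap G _ _ a λ { (c , X) →
  trans (linExt-concatMap G (λ Y → c * linExt G (X ⧢ Y)) _ b λ { (d , Y) →
           trans (linExt-scale G (c * d) (X ⧢ Y)) (lemma c d (linExt G (X ⧢ Y))) })
        (linExt-*ˡ c _ b) }
  where lemma : ∀ c d g → c * d * g ≡ d * (c * g)
        lemma = RingSolver.solve-∀ ℚ-ring

indicator : Word → Word → ℚ
indicator w v = if does (v ≟W w) then 1ℚ else 0ℚ

indicator-≢0 : ∀ {w v} → indicator w v ≢ 0ℚ → v ≡ w
indicator-≢0 {w} {v} ne with v ≟W w
... | yes v≡w = v≡w
... | no _ = ⊥-elim (ne refl)

coeff-linExt : ∀ a w → coeff a w ≡ linExt (indicator w) a
coeff-linExt [] w = refl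
coeff-linExt ((c , v) ∷ a) w with v ≟W w
... | yes _ = cong₂ _+_ (sym (ℚP.*-identityʳ c)) (coeff-linExt a w)
... | no _ = trans (coeff-linExt a w)
                   (sym (trans (cong (_+ linExt (indicator w) a) (ℚP.*-zeroʳ c)) (ℚP.+-identityˡ _)))

removeWord : Word → LC → LC
removeWord y [] = []
removeWord y ((c , v) ∷ a) with v ≟W y
... | yes _ = removeWord y a
... | no _ = (c , v) ∷ removeWord y a

module _ (y : Word) where

  linExt-removeWord : ∀ G a → linExt G a ≡ coeff a y * G y + linExt G (removeWord y a)
  linExt-removeWord G [] = sym (trans (cong (_+ 0ℚ) (ℚP.*-zeroˡ (G y))) (ℚP.+-identityʳ 0ℚ))
  linExt-removeWord G ((c , v) ∷ a) with v ≟W y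
  ... | yes refl = trans (cong (_+_ (c * G v)) (linExt-removeWord G a)) (lemma c (coeff a v) (G v) _)
    where lemma : ∀ c k g s → c * g + (k * g + s) ≡ (c + k) * g + s
          lemma = RingSolver.solve-∀ ℚ-ring
  ... | no _ = trans (cong (_+_ (c * G v)) (linExt-removeWord G a)) (lemma (c * G v) (coeff a y * G y) _)
    where lemma : ∀ p q s → p + (q + s) ≡ q + (p + s)
          lemma = RingSolver.solve-∀ ℚ-ring

  coeff-removeWord-self : ∀ a → coeff (removeWord y a) y ≡ 0ℚ
  coeff-removeWord-self [] = refl
  coeff-removeWord-self ((c , v) ∷ a) with v ≟W y
  ... | yes _ = coeff-removeWord-self a
  ... | no v≢y with v ≟W y
  ...   | yes v≡y = ⊥-elim (v≢y v≡y)
  ...   | no _ = coeff-removeWord-self a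

  coeff-removeWord-other : ∀ {w} a → w ≢ y → coeff (removeWord y a) w ≡ coeff a w
  coeff-removeWord-other [] _ = refl
  coeff-removeWord-other {w} ((c , v) ∷ a) w≢y with v ≟W y
  ... | yes refl with v ≟W w
  ...   | yes refl = ⊥-elim (w≢y refl)
  ...   | no _ = coeff-removeWord-other a w≢y
  coeff-removeWord-other {w} ((c , v) ∷ a) w≢y | no _ with v ≟W w
  ...   | yes _ = cong (_+_ c) (coeff-removeWord-other a w≢y)
  ...   | no _ = coeff-removeWord-other a w≢y

  length-removeWord : ∀ a → length (removeWord y a) ℕ.≤ length a
  length-removeWord [] = ℕ.z≤n
  length-removeWord ((c , v) ∷ a) with v ≟W y
  ... | yes _ = ℕP.m≤n⇒m≤1+n (length-removeWord a)
  ... | no _ = ℕ.s≤s (length-removeWord a)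

  length-removeWord-head : ∀ c a → length (removeWord y ((c , y) ∷ a)) ℕ.≤ length a
  length-removeWord-head c a with y ≟W y
  ... | yes _ = length-removeWord a
  ... | no y≢y = ⊥-elim (y≢y refl)

*≢0ˡ : ∀ {p q} → p * q ≢ 0ℚ → p ≢ 0ℚ
*≢0ˡ {q = q} ne refl = ne (ℚP.*-zeroˡ q)

*≢0ʳ : ∀ {p q} → p * q ≢ 0ℚ → q ≢ 0ℚ
*≢0ʳ {p} ne refl = ne (ℚP.*-zeroʳ p)

-- Induction on the length: the head word y is removed from a together with all its repetitions.
support-witness : ∀ G a → linExt G a ≢ 0ℚ → ∃ λ w → coeff a w ≢ 0ℚ × G w ≢ 0ℚ
support-witness G a = go (length a) a ℕP.≤-refl
  where
  go : ∀ n a → length a ℕ.≤ n → linExt G a ≢ 0ℚ → ∃ λ w → coeff a w ≢ 0ℚ × G w ≢ 0ℚ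
  go _ [] _ ne = ⊥-elim (ne refl)
  go (suc n) a@((c , y) ∷ a′) (ℕ.s≤s len) ne with coeff a y * G y ℚP.≟ 0ℚ
  ... | no ne′ = y , *≢0ˡ {q = G y} ne′ , *≢0ʳ {p = coeff a y} ne′
  ... | yes z with go n (removeWord y a) (ℕP.≤-trans (length-removeWord-head y c a′) len) rest≢0
    where rest≢0 : linExt G (removeWord y a) ≢ 0ℚ
          rest≢0 e = ne (trans (linExt-removeWord y G a) (trans (cong₂ _+_ z e) (ℚP.+-identityʳ 0ℚ)))
  ...   | w , cw , gw = w , (λ e → cw (trans (coeff-removeWord-other y a w≢y) e)) , gw
    where w≢y : w ≢ y
          w≢y refl = cw (coeff-removeWord-self y a)

AllW⇒InSpan : ∀ {P} a → AllW P a → InSpan P a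
AllW⇒InSpan [] [] w ne = ⊥-elim (ne refl)
AllW⇒InSpan ((c , v) ∷ a) (pv ∷ ps) w ne with v ≟W w
... | yes refl = pv
... | no _ = AllW⇒InSpan a ps w ne

⧢ᴸ-support : ∀ a b w → coeff (a ⧢ᴸ b) w ≢ 0ℚ
           → ∃₂ λ X Y → coeff a X ≢ 0ℚ × coeff b Y ≢ 0ℚ × coeff (X ⧢ Y) w ≢ 0ℚ
⧢ᴸ-support a b w ne
  with support-witness _ a (ne ∘ trans (trans (coeff-linExt (a ⧢ᴸ b) w) (linExt-⧢ᴸ (indicator w) a b)))
... | X , cX , inner with support-witness _ b inner
...   | Y , cY , cXY = X , Y , cX , cY , cXY ∘ trans (sym (coeff-linExt (X ⧢ Y) w))

mapW-support : ∀ f a w → coeff (mapW f a) w ≢ 0ℚ → ∃ λ v → coeff a v ≢ 0ℚ × f v ≡ w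
mapW-support f a w ne
  with support-witness _ a (ne ∘ trans (trans (coeff-linExt (mapW f a) w) (linExt-mapW (indicator w) f a)))
... | v , cv , iv = v , cv , indicator-≢0 iv

module _ {P : Word → Set} where

  AllW-η : ∀ {w} → P w → AllW P (η w)
  AllW-η p = p ∷ []

  AllW-⊕ : ∀ {a b} → AllW P a → AllW P b → AllW P (a ⊕ b)
  AllW-⊕ = AllP.++⁺

  AllW-⊖ : ∀ {a b} → AllW P a → AllW P b → AllW P (a ⊖ b)
  AllW-⊖ pa pb = AllP.++⁺ pa (AllP.map⁺ pb)

  module _ {Q : Word → Set} where

    AllW-mapW : ∀ {f a} → (∀ {r} → Q r → P (f r)) → AllW Q a → AllW P (mapW f a)
    AllW-mapW h qa = AllP.map⁺ (All.map h qa)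

    AllW-shift : ∀ d {a} → (∀ s u w → Q ((s , u) ∷ w) → P ((s ℤ.+ d , u) ∷ w))
               → AllW Q a → AllW P (shift d a)
    AllW-shift d h [] = []
    AllW-shift d {(_ , []) ∷ _} h (_ ∷ qa) = AllW-shift d h qa
    AllW-shift d {(_ , (s , u) ∷ w) ∷ _} h (q ∷ qa) = h s u w q ∷ AllW-shift d h qa

record ShuffleInduction (M : Word → Word → LC → Set) : Set where
  field
    unitˡ    : ∀ {Y} → M [] Y (η Y)
    unitʳ    : ∀ {c w} → M (c ∷ w) [] (η (c ∷ w))
    rule-i   : ∀ {u w Y l} → M w Y l → M ((+ 0 , u) ∷ w) Y (pre (+ 0 , u) l)
    rule-ii  : ∀ {X v y l} → M X y l → M X ((+ 0 , v) ∷ y) (pre (+ 0 , v) l)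
    rule-iii : ∀ {a u w b v y l₁ l₂}
             → M ((+ suc a , u) ∷ w) ((+ b , v) ∷ y) l₁
             → M ((+ a , u) ∷ w) ((+ suc b , v) ∷ y) l₂
             → M ((+ suc a , u) ∷ w) ((+ suc b , v) ∷ y) (IS l₁ ⊕ IS l₂)
    rule-iv  : ∀ {a u w n v y l₁ l₂}
             → M ((+ suc a , u) ∷ w) ((ℤ.suc -[1+ n ] , v) ∷ y) l₁
             → M ((+ a , u) ∷ w) ((ℤ.suc -[1+ n ] , v) ∷ y) l₂
             → M ((+ suc a , u) ∷ w) ((-[1+ n ] , v) ∷ y) (JS l₁ ⊖ l₂)
    rule-v   : ∀ {n u w t v y l₁ l₂}
             → M ((ℤ.suc -[1+ n ] , u) ∷ w) ((t , v) ∷ y) l₁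
             → M ((ℤ.suc -[1+ n ] , u) ∷ w) ((t ℤ.- + 1 , v) ∷ y) l₂
             → M ((-[1+ n ] , u) ∷ w) ((t , v) ∷ y) (JS l₁ ⊖ l₂)

module _ {M : Word → Word → LC → Set} (ind : ShuffleInduction M) where
  open ShuffleInduction ind

  mutual
    ⧢-induction : ∀ X Y → M X Y (X ⧢ Y)
    ⧢-induction [] Y = unitˡ
    ⧢-induction ((s , u) ∷ w) Y = A-induction s u w Y

    private
      A-induction : ∀ s u w Y → M ((s , u) ∷ w) Y (A s u w Y)
      A-induction s u w [] = unitʳ
      A-induction (+ zero) u w ((t , v) ∷ y) = B0-induction u w t v y
      A-induction (+ suc a) u w ((t , v) ∷ y) = Bpos-induction a u w t v y
      A-induction -[1+ n ] u w ((t , v) ∷ y) = Bneg-induction n u w t v y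

      B0-induction : ∀ u w t v y → M ((+ 0 , u) ∷ w) ((t , v) ∷ y) (B0 u w t v y)
      B0-induction u w t v y = rule-i (⧢-induction w ((t , v) ∷ y))

      Bpos-induction : ∀ a u w t v y → M ((+ suc a , u) ∷ w) ((t , v) ∷ y) (Bpos a u w t v y)
      Bpos-induction a u w (+ zero) v y = rule-ii (A-induction (+ suc a) u w y)
      Bpos-induction a u w (+ suc b) v y =
        rule-iii (Bpos-induction a u w (+ b) v y) (Bsm-induction a u w (+ suc b) v y)
      Bpos-induction a u w -[1+ zero ] v y =
        rule-iv (rule-ii (A-induction (+ suc a) u w y)) (Bsm-induction a u w (+ 0) v y)
      Bpos-induction a u w -[1+ suc n ] v y =
        rule-iv (Bpos-induction a u w -[1+ n ] v y) (Bsm-induction a u w -[1+ n ] v y)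

      Bsm-induction : ∀ a u w t v y → M ((+ a , u) ∷ w) ((t , v) ∷ y) (Bsm a u w t v y)
      Bsm-induction zero = B0-induction
      Bsm-induction (suc a) = Bpos-induction a

      Bneg-induction : ∀ n u w t v y → M ((-[1+ n ] , u) ∷ w) ((t , v) ∷ y) (Bneg n u w t v y)
      Bneg-induction zero u w t v y =
        rule-v (B0-induction u w t v y) (B0-induction u w (t ℤ.- + 1) v y)
      Bneg-induction (suc n) u w t v y =
        rule-v (Bneg-induction n u w t v y) (Bneg-induction n u w (t ℤ.- + 1) v y)

BottomsOf : Word → Word → Word → Set
BottomsOf X Y r = bottoms r ↭ bottoms X ++ bottoms Y

bottoms-induction : ShuffleInduction (λ X Y → AllW (BottomsOf X Y))
bottoms-induction = record
  { unitˡ    = AllW-η ↭-refl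
  ; unitʳ    = AllW-η (↭-reflexive (sym (LP.++-identityʳ _)))
  ; rule-i   = AllW-mapW (prep _)
  ; rule-ii  = λ {X} {v} {y} → AllW-mapW (λ p → ↭-trans (prep v p) (↭-sym (PermP.shift v (bottoms X) (bottoms y))))
  ; rule-iii = λ p₁ p₂ → AllW-⊕ (AllW-shift (+ 1) (λ _ _ _ → id) p₁) (AllW-shift (+ 1) (λ _ _ _ → id) p₂)
  ; rule-iv  = λ p₁ p₂ → AllW-⊖ (AllW-shift ℤ.-1ℤ (λ _ _ _ → id) p₁) p₂
  ; rule-v   = λ p₁ p₂ → AllW-⊖ (AllW-shift ℤ.-1ℤ (λ _ _ _ → id) p₁) p₂
  }

⧢-bottoms : ∀ X Y → AllW (BottomsOf X Y) (X ⧢ Y)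
⧢-bottoms = ⧢-induction bottoms-induction

Chen-shuffle : ∀ {X Y r} → Chen X → Chen Y → DisjointB X Y → BottomsOf X Y r → Chen r
Chen-shuffle (uX , pX) (uY , pY) X#Y r↭ =
  PermSetoidP.Unique-resp-↭ (setoid ℕ) (↭⇒↭ₛ (↭-sym r↭))
    (UniqueP.++⁺ uX uY λ (i∈X , i∈Y) → X#Y _ i∈X i∈Y) ,
  PermP.All-resp-↭ (↭-sym r↭) (AllP.++⁺ pX pY)

-- s₁ + ⋯ + s_j − j; once j passes the length of the word it stays at its final value
excess : ℕ → Word → ℤ
excess zero _ = ℤ.0ℤ
excess (suc j) [] = ℤ.0ℤ
excess (suc j) ((s , _) ∷ w) = s ℤ.- + 1 ℤ.+ excess j w

Good : ℤ → Word → Word → Set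
Good δ X Y = ∀ p q → (p , q) ≢ (0 , 0) → ℤ.0ℤ ℤ.< excess p X ℤ.+ excess q Y ℤ.+ δ

Bounded : ℤ → Word → Set
Bounded δ r = ∀ j → ℤ.0ℤ ℤ.< excess (suc j) r ℤ.+ δ

0<-resp : ∀ {a b} → a ≡ b → ℤ.0ℤ ℤ.< a → ℤ.0ℤ ℤ.< b
0<-resp = subst (ℤ.0ℤ ℤ.<_)

0<-weaken : ∀ {a b t} → t ℤ.≤ ℤ.0ℤ → a ≡ b ℤ.+ t → ℤ.0ℤ ℤ.< a → ℤ.0ℤ ℤ.< b
0<-weaken {b = b} t≤0 refl 0<a =
  ℤP.<-≤-trans 0<a (ℤP.≤-trans (ℤP.+-monoʳ-≤ b t≤0) (ℤP.≤-reflexive (ℤP.+-identityʳ b)))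

Good-sym : ∀ {δ X Y} → Good δ X Y → Good δ Y X
Good-sym {δ} {X} {Y} g p q pq≢0 =
  0<-resp (cong (ℤ._+ δ) (ℤP.+-comm (excess q X) (excess p Y))) (g q p λ { refl → pq≢0 refl })

module _ {δ : ℤ} {X : Word} {v : ℕ} {y : Word} where

  Good-dropʳ : Good δ X ((+ 0 , v) ∷ y) → Good (δ ℤ.- + 1) X y
  Good-dropʳ g p q _ = 0<-resp (lemma (excess p X) (excess q y) δ) (g p (suc q) λ ())
    where lemma : ∀ e f δ → e ℤ.+ (+ 0 ℤ.- + 1 ℤ.+ f) ℤ.+ δ ≡ e ℤ.+ f ℤ.+ (δ ℤ.- + 1)
          lemma = ℤ-solve-∀

  Good-lowerʳ : ∀ {t t′} → t ≡ + 1 ℤ.+ t′ → Good δ X ((t , v) ∷ y) → Good (δ ℤ.+ + 1) X ((t′ , v) ∷ y)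
  Good-lowerʳ refl g p zero pq≢0 = 0<-weaken (ℤ.-≤+ {0} {0}) (lemma (excess p X) δ) (g p 0 pq≢0)
    where lemma : ∀ e δ → e ℤ.+ ℤ.0ℤ ℤ.+ δ ≡ e ℤ.+ ℤ.0ℤ ℤ.+ (δ ℤ.+ + 1) ℤ.+ ℤ.-1ℤ
          lemma = ℤ-solve-∀
  Good-lowerʳ {t′ = t′} refl g p (suc q) _ =
    0<-resp (lemma (excess p X) (excess q y) δ t′) (g p (suc q) λ ())
    where lemma : ∀ e f δ t → e ℤ.+ (+ 1 ℤ.+ t ℤ.- + 1 ℤ.+ f) ℤ.+ δ
                            ≡ e ℤ.+ (t ℤ.- + 1 ℤ.+ f) ℤ.+ (δ ℤ.+ + 1)
          lemma = ℤ-solve-∀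

  Good-raiseʳ : ∀ {t} → t ℤ.≤ ℤ.0ℤ → Good δ X ((t , v) ∷ y) → Good (δ ℤ.- + 1) X ((+ 1 ℤ.+ t , v) ∷ y)
  Good-raiseʳ {t} t≤0 g p zero pq≢0 = 0<-weaken t≤0 (lemma (excess p X) δ t) (g p 1 λ ())
    where lemma : ∀ e δ t → e ℤ.+ (t ℤ.- + 1 ℤ.+ ℤ.0ℤ) ℤ.+ δ ≡ e ℤ.+ ℤ.0ℤ ℤ.+ (δ ℤ.- + 1) ℤ.+ t
          lemma = ℤ-solve-∀
  Good-raiseʳ {t} _ g p (suc q) _ = 0<-resp (lemma (excess p X) (excess q y) δ t) (g p (suc q) λ ())
    where lemma : ∀ e f δ t → e ℤ.+ (t ℤ.- + 1 ℤ.+ f) ℤ.+ δ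
                            ≡ e ℤ.+ (+ 1 ℤ.+ t ℤ.- + 1 ℤ.+ f) ℤ.+ (δ ℤ.- + 1)
          lemma = ℤ-solve-∀

module _ {δ : ℤ} {u : ℕ} {w Y : Word} where

  Good-dropˡ : Good δ ((+ 0 , u) ∷ w) Y → Good (δ ℤ.- + 1) w Y
  Good-dropˡ = Good-sym ∘ Good-dropʳ ∘ Good-sym

  Good-lowerˡ : ∀ {s s′} → s ≡ + 1 ℤ.+ s′ → Good δ ((s , u) ∷ w) Y → Good (δ ℤ.+ + 1) ((s′ , u) ∷ w) Y
  Good-lowerˡ e = Good-sym ∘ Good-lowerʳ e ∘ Good-sym

  Good-raiseˡ : ∀ {s} → s ℤ.≤ ℤ.0ℤ → Good δ ((s , u) ∷ w) Y → Good (δ ℤ.- + 1) ((+ 1 ℤ.+ s , u) ∷ w) Y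
  Good-raiseˡ s≤0 = Good-sym ∘ Good-raiseʳ s≤0 ∘ Good-sym

  Good-zero-head : Good δ ((+ 0 , u) ∷ w) Y → ℤ.0ℤ ℤ.< δ ℤ.- + 1
  Good-zero-head g = 0<-resp (lemma δ) (g 1 0 λ ())
    where lemma : ∀ δ → + 0 ℤ.- + 1 ℤ.+ ℤ.0ℤ ℤ.+ ℤ.0ℤ ℤ.+ δ ≡ δ ℤ.- + 1
          lemma = ℤ-solve-∀

Bounded-unitˡ : ∀ {δ Y} → Good δ [] Y → Bounded δ Y
Bounded-unitˡ {δ} {Y} g j = 0<-resp (cong (ℤ._+ δ) (ℤP.+-identityˡ (excess (suc j) Y))) (g 0 (suc j) λ ())

Bounded-unitʳ : ∀ {δ X} → Good δ X [] → Bounded δ X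
Bounded-unitʳ {δ} {X} g j = 0<-resp (cong (ℤ._+ δ) (ℤP.+-identityʳ (excess (suc j) X))) (g (suc j) 0 λ ())

Bounded-cons-zero : ∀ {δ u r} → ℤ.0ℤ ℤ.< δ ℤ.- + 1 → Bounded (δ ℤ.- + 1) r → Bounded δ ((+ 0 , u) ∷ r)
Bounded-cons-zero {δ} h _ zero = 0<-resp (lemma δ) h
  where lemma : ∀ δ → δ ℤ.- + 1 ≡ + 0 ℤ.- + 1 ℤ.+ ℤ.0ℤ ℤ.+ δ
        lemma = ℤ-solve-∀
Bounded-cons-zero {δ} {r = r} _ b (suc j) = 0<-resp (lemma (excess (suc j) r) δ) (b j)
  where lemma : ∀ e δ → e ℤ.+ (δ ℤ.- + 1) ≡ + 0 ℤ.- + 1 ℤ.+ e ℤ.+ δ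
        lemma = ℤ-solve-∀

Bounded-shift : ∀ δ d s u r → Bounded (δ ℤ.+ d) ((s , u) ∷ r) → Bounded δ ((s ℤ.+ d , u) ∷ r)
Bounded-shift δ d s u r b j = 0<-resp (lemma s d (excess j r) δ) (b j)
  where lemma : ∀ s d e δ → s ℤ.- + 1 ℤ.+ e ℤ.+ (δ ℤ.+ d) ≡ s ℤ.+ d ℤ.- + 1 ℤ.+ e ℤ.+ δ
        lemma = ℤ-solve-∀

⧢-bounded : ∀ X Y δ → Good δ X Y → AllW (Bounded δ) (X ⧢ Y)
⧢-bounded = ⧢-induction {M = λ X Y l → ∀ δ → Good δ X Y → AllW (Bounded δ) l} record
  { unitˡ    = λ _ g → AllW-η (Bounded-unitˡ g)
  ; unitʳ    = λ _ g → AllW-η (Bounded-unitʳ g)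
  ; rule-i   = λ {u = u} ih δ g →
      AllW-mapW (Bounded-cons-zero {δ} {u} (Good-zero-head g)) (ih _ (Good-dropˡ g))
  ; rule-ii  = λ {v = v} ih δ g →
      AllW-mapW (Bounded-cons-zero {δ} {v} (Good-zero-head (Good-sym g))) (ih _ (Good-dropʳ g))
  ; rule-iii = λ ih₁ ih₂ δ g →
      AllW-⊕ (AllW-shift (+ 1) (Bounded-shift δ (+ 1)) (ih₁ _ (Good-lowerʳ refl g)))
             (AllW-shift (+ 1) (Bounded-shift δ (+ 1)) (ih₂ _ (Good-lowerˡ refl g)))
  ; rule-iv  = λ ih₁ ih₂ δ g →
      AllW-⊖ (AllW-shift ℤ.-1ℤ (Bounded-shift δ ℤ.-1ℤ) (ih₁ _ (Good-raiseʳ ℤ.-≤+ g)))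
             (ih₂ δ (subst (λ d → Good d _ _) (+1-1 δ) (Good-raiseʳ ℤ.-≤+ (Good-lowerˡ refl g))))
  ; rule-v   = λ {t = t} ih₁ ih₂ δ g →
      AllW-⊖ (AllW-shift ℤ.-1ℤ (Bounded-shift δ ℤ.-1ℤ) (ih₁ _ (Good-raiseˡ ℤ.-≤+ g)))
             (ih₂ δ (subst (λ d → Good d _ _) (-1+1 δ) (Good-lowerʳ (1+[t-1] t) (Good-raiseˡ ℤ.-≤+ g))))
  }
  where
  +1-1 : ∀ δ → δ ℤ.+ + 1 ℤ.- + 1 ≡ δ
  +1-1 = ℤ-solve-∀
  -1+1 : ∀ δ → δ ℤ.- + 1 ℤ.+ + 1 ≡ δ
  -1+1 = ℤ-solve-∀
  1+[t-1] : ∀ t → t ≡ + 1 ℤ.+ (t ℤ.- + 1)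
  1+[t-1] = ℤ-solve-∀

sumℤ-take-tops : ∀ j w → j ℕ.≤ length w → sumℤ (take j (tops w)) ≡ + j ℤ.+ excess j w
sumℤ-take-tops zero w _ = refl
sumℤ-take-tops (suc j) ((s , _) ∷ w) (ℕ.s≤s j≤) =
  trans (cong (ℤ._+_ s) (sumℤ-take-tops j w j≤)) (lemma s (+ j) (excess j w))
  where lemma : ∀ s J e → s ℤ.+ (J ℤ.+ e) ≡ + 1 ℤ.+ J ℤ.+ (s ℤ.- + 1 ℤ.+ e)
        lemma = ℤ-solve-∀

excess-saturates : ∀ j w → length w ℕ.≤ j → excess j w ≡ excess (length w) w
excess-saturates zero [] _ = refl
excess-saturates (suc j) [] _ = refl
excess-saturates (suc j) ((s , _) ∷ w) (ℕ.s≤s w≤j) = cong (ℤ._+_ (s ℤ.- + 1)) (excess-saturates j w w≤j)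

cancel-< : ∀ k e → k ℤ.< k ℤ.+ e → ℤ.0ℤ ℤ.< e
cancel-< k e h = subst₂ ℤ._<_ (ℤP.+-inverseˡ k) (lemma k e) (ℤP.+-monoʳ-< (ℤ.- k) h)
  where lemma : ∀ k e → ℤ.- k ℤ.+ (k ℤ.+ e) ≡ e
        lemma = ℤ-solve-∀

ConvTops⇒excess-pos-within : ∀ w → ConvTops w → ∀ j → suc j ℕ.≤ length w → ℤ.0ℤ ℤ.< excess (suc j) w
ConvTops⇒excess-pos-within w ct j j< =
  cancel-< (+ suc j) _ (subst (+ suc j ℤ.<_) (sumℤ-take-tops (suc j) w j<) (ct (suc j) (ℕ.s≤s ℕ.z≤n) j<))

ConvTops⇒excess-pos : ∀ c w → ConvTops (c ∷ w) → ∀ j → ℤ.0ℤ ℤ.< excess (suc j) (c ∷ w)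
ConvTops⇒excess-pos c w ct j with suc j ℕ.≤? length (c ∷ w)
... | yes j< = ConvTops⇒excess-pos-within (c ∷ w) ct j j<
... | no j≮ = subst (ℤ.0ℤ ℤ.<_) (sym (excess-saturates (suc j) (c ∷ w) (ℕP.≰⇒≥ j≮)))
                    (ConvTops⇒excess-pos-within (c ∷ w) ct (length w) ℕP.≤-refl)

Bounded⇒ConvTops : ∀ {r} → Bounded ℤ.0ℤ r → ConvTops r
Bounded⇒ConvTops {r} b (suc j) _ j≤ = subst (+ suc j ℤ.<_) (sym (sumℤ-take-tops (suc j) r j≤))
  (subst (ℤ._< + suc j ℤ.+ excess (suc j) r) (ℤP.+-identityʳ (+ suc j))
         (ℤP.+-monoʳ-< (+ suc j) (0<-resp (ℤP.+-identityʳ (excess (suc j) r)) (b j))))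

Good-init : ∀ {X Y} → (∀ j → ℤ.0ℤ ℤ.< excess (suc j) X) → (∀ j → ℤ.0ℤ ℤ.< excess (suc j) Y)
          → Good ℤ.0ℤ X Y
Good-init _ _ zero zero pq≢0 = ⊥-elim (pq≢0 refl)
Good-init posX _ (suc p) zero _ = 0<-resp (pad _) (posX p)
  where pad : ∀ e → e ≡ e ℤ.+ ℤ.0ℤ ℤ.+ ℤ.0ℤ
        pad = ℤ-solve-∀
Good-init _ posY zero (suc q) _ = 0<-resp (pad _) (posY q)
  where pad : ∀ e → e ≡ ℤ.0ℤ ℤ.+ e ℤ.+ ℤ.0ℤ
        pad = ℤ-solve-∀
Good-init posX posY (suc p) (suc q) _ = 0<-resp (sym (ℤP.+-identityʳ _)) (ℤP.+-mono-< (posX p) (posY q))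

⧢-Conv : ∀ {X Y} → Conv X → Conv Y → X ⊤W Y → AllW Conv (X ⧢ Y)
⧢-Conv {[]} _ cY _ = AllW-η cY
⧢-Conv {_ ∷ _} {[]} cX _ _ = AllW-η cX
⧢-Conv {_ ∷ _} {_ ∷ _} _ _ (inj₁ ())
⧢-Conv {_ ∷ _} {_ ∷ _} _ _ (inj₂ (inj₁ ()))
⧢-Conv {_ ∷ _} {_ ∷ _} (inj₁ ()) _ _
⧢-Conv {_ ∷ _} {_ ∷ _} _ (inj₁ ()) _
⧢-Conv {X@(c ∷ w)} {Y@(d ∷ y)} (inj₂ (_ , ctX)) (inj₂ (_ , ctY)) (inj₂ (inj₂ (chX , chY , X#Y))) =
  All.zipWith (λ {(_ , r)} (r↭ , b) → inj₂ (Chen-shuffle {X} {Y} chX chY X#Y r↭ , Bounded⇒ConvTops {r} b))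
    (⧢-bottoms X Y ,
     ⧢-bounded X Y ℤ.0ℤ (Good-init (ConvTops⇒excess-pos c w ctX) (ConvTops⇒excess-pos d y ctY)))

⧢ᴸ-preserves-Conv : ∀ a b → InSpan Conv a → InSpan Conv b → a ⊤L b → InSpan Conv (a ⧢ᴸ b)
⧢ᴸ-preserves-Conv a b ca cb a⊤b w ne with ⧢ᴸ-support a b w ne
... | X , Y , cX , cY , cw = AllW⇒InSpan (X ⧢ Y) (⧢-Conv (ca X cX) (cb Y cY) (a⊤b X Y cX cY)) w cw

inv-inverseˡ : ∀ {q} → q ≢ 0ℚ → inv q * q ≡ 1ℚ
inv-inverseˡ {q} q≢0 with q ℚP.≟ 0ℚ
... | yes q≡0 = ⊥-elim (q≢0 q≡0)
... | no q≢0′ = ℚP.*-inverseˡ q {{ℚ.≢-nonZero q≢0′}}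

inv-inverseʳ : ∀ {q} → q ≢ 0ℚ → q * inv q ≡ 1ℚ
inv-inverseʳ {q} q≢0 = trans (ℚP.*-comm q (inv q)) (inv-inverseˡ q≢0)

inv-cancelˡ : ∀ {q} → q ≢ 0ℚ → ∀ p → inv q * (q * p) ≡ p
inv-cancelˡ {q} q≢0 p =
  trans (sym (ℚP.*-assoc (inv q) q p)) (trans (cong (_* p) (inv-inverseˡ q≢0)) (ℚP.*-identityˡ p))

inv-cancelʳ : ∀ {q} → q ≢ 0ℚ → ∀ p → q * (inv q * p) ≡ p
inv-cancelʳ {q} q≢0 p =
  trans (sym (ℚP.*-assoc q (inv q) p)) (trans (cong (_* p) (inv-inverseʳ q≢0)) (ℚP.*-identityˡ p))

inv-+ : ∀ {p q} → p ≢ 0ℚ → q ≢ 0ℚ → p + q ≢ 0ℚ → inv (p + q) * (inv p + inv q) ≡ inv p * inv q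
inv-+ {p} {q} p≢0 q≢0 p+q≢0 = sym (begin
  P * Q                            ≡⟨ sym (ℚP.*-identityʳ (P * Q)) ⟩
  P * Q * 1ℚ                       ≡⟨ cong (P * Q *_) (sym (inv-inverseˡ p+q≢0)) ⟩
  P * Q * (R * (p + q))            ≡⟨ regroup P Q R p q ⟩
  R * (Q * (P * p) + P * (Q * q))  ≡⟨ cong₂ (λ a b → R * (Q * a + P * b)) (inv-inverseˡ p≢0) (inv-inverseˡ q≢0) ⟩
  R * (Q * 1ℚ + P * 1ℚ)            ≡⟨ unit R P Q ⟩
  R * (P + Q)                      ∎)
  where
  open ≡-Reasoning
  R = inv (p + q)
  P = inv p
  Q = inv q
  regroup : ∀ P Q R p q → P * Q * (R * (p + q)) ≡ R * (Q * (P * p) + P * (Q * q))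
  regroup = RingSolver.solve-∀ ℚ-ring
  unit : ∀ R P Q → R * (Q * 1ℚ + P * 1ℚ) ≡ R * (P + Q)
  unit = RingSolver.solve-∀ ℚ-ring

partial-fractions : ∀ R P Q α φ β ψ → R * (P + Q) ≡ P * Q
  → R * (((P * α) * φ) * (β * ψ)) + R * ((α * φ) * ((Q * β) * ψ)) ≡ ((P * α) * φ) * ((Q * β) * ψ)
partial-fractions R P Q α φ β ψ h = begin
  R * (((P * α) * φ) * (β * ψ)) + R * ((α * φ) * ((Q * β) * ψ))  ≡⟨ factor R P Q α φ β ψ ⟩
  R * (P + Q) * (α * φ * β * ψ)                                   ≡⟨ cong (_* (α * φ * β * ψ)) h ⟩
  P * Q * (α * φ * β * ψ)                                         ≡⟨ unfactor P Q α φ β ψ ⟩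
  ((P * α) * φ) * ((Q * β) * ψ)                                   ∎
  where
  open ≡-Reasoning
  factor : ∀ R P Q α φ β ψ → R * (((P * α) * φ) * (β * ψ)) + R * ((α * φ) * ((Q * β) * ψ))
                           ≡ R * (P + Q) * (α * φ * β * ψ)
  factor = RingSolver.solve-∀ ℚ-ring
  unfactor : ∀ P Q α φ β ψ → P * Q * (α * φ * β * ψ) ≡ ((P * α) * φ) * ((Q * β) * ψ)
  unfactor = RingSolver.solve-∀ ℚ-ring

lower-and-raise : ∀ p q P α φ g → P * p ≡ 1ℚ
  → (p + q) * (((P * α) * φ) * g) - (α * φ) * g ≡ ((P * α) * φ) * (q * g)
lower-and-raise p q P α φ g h = begin
  (p + q) * (((P * α) * φ) * g) - (α * φ) * g
    ≡⟨ cong (_-_ ((p + q) * (((P * α) * φ) * g))) (sym Pp·m≡m) ⟩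
  (p + q) * (((P * α) * φ) * g) - (P * p) * ((α * φ) * g)  ≡⟨ regroup p q P α φ g ⟩
  ((P * α) * φ) * (q * g)                                  ∎
  where
  open ≡-Reasoning
  Pp·m≡m : (P * p) * ((α * φ) * g) ≡ (α * φ) * g
  Pp·m≡m = trans (cong (_* ((α * φ) * g)) h) (ℚP.*-identityˡ _)
  regroup : ∀ p q P α φ g → (p + q) * (((P * α) * φ) * g) - (P * p) * ((α * φ) * g) ≡ ((P * α) * φ) * (q * g)
  regroup = RingSolver.solve-∀ ℚ-ring

powNeg-suc : ∀ {q} → q ≢ 0ℚ → ∀ s → powNeg q (s ℤ.+ + 1) ≡ inv q * powNeg q s
powNeg-suc {q} _ (+ n) = cong (powℕ (inv q)) (ℕP.+-comm n 1)
powNeg-suc {q} q≢0 -[1+ zero ] = sym (trans (cong (inv q *_) (ℚP.*-identityʳ q)) (inv-inverseˡ q≢0))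
powNeg-suc {q} q≢0 -[1+ suc n ] = sym (inv-cancelˡ q≢0 (powℕ q (suc n)))

powNeg-pred : ∀ {q} → q ≢ 0ℚ → ∀ s → powNeg q (s ℤ.+ ℤ.-1ℤ) ≡ q * powNeg q s
powNeg-pred {q} _ (+ zero) = refl
powNeg-pred {q} q≢0 (+ suc n) = sym (inv-cancelʳ q≢0 (powℕ (inv q) n))
powNeg-pred {q} _ -[1+ n ] = cong (λ k → powℕ q (suc (suc k))) (ℕP.+-identityʳ n)

powNeg-neg : ∀ q n → powNeg q -[1+ n ] ≡ q * powNeg q (ℤ.suc -[1+ n ])
powNeg-neg q zero = refl
powNeg-neg q (suc n) = refl

pos+nonneg : ∀ {p q} → 0ℚ ℚ.< p → 0ℚ ℚ.≤ q → 0ℚ ℚ.< p + q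
pos+nonneg {p} {q} 0<p 0≤q = subst (ℚ._< p + q) (ℚP.+-identityʳ 0ℚ) (ℚP.+-mono-<-≤ 0<p 0≤q)

module Evaluation (x : ℕ → ℚ) (x>0 : Pos x) where

  F : Word → ℚ
  F w = frac w x

  S : Word → ℚ
  S = sumVars x

  S-nonneg : ∀ w → 0ℚ ℚ.≤ S w
  S-pos : ∀ c w → 0ℚ ℚ.< S (c ∷ w)
  S-nonneg [] = ℚP.≤-refl
  S-nonneg (c ∷ w) = ℚP.<⇒≤ (S-pos c w)
  S-pos (_ , u) w = pos+nonneg (x>0 u) (S-nonneg w)

  S≢0 : ∀ c w → S (c ∷ w) ≢ 0ℚ
  S≢0 c w = ℚP.<⇒≢ (S-pos c w) ∘ sym

  S+S≢0 : ∀ c w Y → S (c ∷ w) + S Y ≢ 0ℚ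
  S+S≢0 c w Y = ℚP.<⇒≢ (pos+nonneg (S-pos c w) (S-nonneg Y)) ∘ sym

  S-++ : ∀ X Y → S (X ++ Y) ≡ S X + S Y
  S-++ [] Y = sym (ℚP.+-identityˡ (S Y))
  S-++ ((_ , u) ∷ X) Y = trans (cong (_+_ (x u)) (S-++ X Y)) (sym (ℚP.+-assoc (x u) (S X) (S Y)))

  S-bottoms : ∀ w → S w ≡ foldr _+_ 0ℚ (map x (bottoms w))
  S-bottoms [] = refl
  S-bottoms ((_ , u) ∷ w) = cong (_+_ (x u)) (S-bottoms w)

  S-shuffle : ∀ {X Y r} → BottomsOf X Y r → S r ≡ S X + S Y
  S-shuffle {X} {Y} {r} r↭ = begin
    S r                                      ≡⟨ S-bottoms r ⟩
    foldr _+_ 0ℚ (map x (bottoms r))         ≡⟨ PermSetoidP.foldr-commMonoid (setoid ℚ) ℚP.+-0-isCommutativeMonoid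
                                                  (↭⇒↭ₛ (PermP.map⁺ x r↭′)) ⟩
    foldr _+_ 0ℚ (map x (bottoms (X ++ Y)))  ≡⟨ sym (S-bottoms (X ++ Y)) ⟩
    S (X ++ Y)                               ≡⟨ S-++ X Y ⟩
    S X + S Y                                ∎
    where
    open ≡-Reasoning
    r↭′ : bottoms r ↭ bottoms (X ++ Y)
    r↭′ = ↭-trans r↭ (↭-reflexive (sym (LP.map-++ proj₂ X Y)))

  evalF-η : ∀ w → evalF (η w) x ≡ F w
  evalF-η w = trans (ℚP.+-identityʳ _) (ℚP.*-identityˡ _)

  evalF-pre-zero : ∀ u l → evalF (pre (+ 0 , u) l) x ≡ 1ℚ * evalF l x
  evalF-pre-zero u l = trans (linExt-mapW F ((+ 0 , u) ∷_) l) (linExt-*ˡ 1ℚ F l)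

  frac-head : ∀ {s s′ u w} k → powNeg (S ((s , u) ∷ w)) s′ ≡ k * powNeg (S ((s , u) ∷ w)) s
            → F ((s′ , u) ∷ w) ≡ k * F ((s , u) ∷ w)
  frac-head {s} {u = u} {w} k e = trans (cong (_* F w) e) (ℚP.*-assoc k (powNeg (S ((s , u) ∷ w)) s) (F w))

  evalF-shift : ∀ d (k : ℚ → ℚ) → (∀ {q} → q ≢ 0ℚ → ∀ s → powNeg q (s ℤ.+ d) ≡ k q * powNeg q s)
              → ∀ {c w Y l} → AllW (BottomsOf (c ∷ w) Y) l
              → evalF (shift d l) x ≡ k (S (c ∷ w) + S Y) * evalF l x
  evalF-shift d k law {c} {w} {Y} {l} ps = begin
    evalF (shift d l) x                    ≡⟨ linExt-shift F d l ⟩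
    linExt (λ r → evalF (shiftW d r) x) l  ≡⟨ linExt-cong l (All.map shifted ps) ⟩
    linExt (λ r → k K * F r) l             ≡⟨ linExt-*ˡ (k K) F l ⟩
    k K * evalF l x                        ∎
    where
    open ≡-Reasoning
    K = S (c ∷ w) + S Y
    shifted : ∀ {r} → BottomsOf (c ∷ w) Y r → evalF (shiftW d r) x ≡ k K * F r
    shifted {[]} r↭ = ⊥-elim (PermP.¬x∷xs↭[] (↭-sym r↭))
    shifted {(s , u) ∷ r} r↭ = begin
      evalF (shiftW d ((s , u) ∷ r)) x  ≡⟨ evalF-η ((s ℤ.+ d , u) ∷ r) ⟩
      F ((s ℤ.+ d , u) ∷ r)
        ≡⟨ frac-head {s} {s ℤ.+ d} {u} {r} (k (S ((s , u) ∷ r))) (law (S≢0 (s , u) r) s) ⟩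
      k (S ((s , u) ∷ r)) * F ((s , u) ∷ r)
        ≡⟨ cong (λ q → k q * F ((s , u) ∷ r)) (S-shuffle {c ∷ w} {Y} {(s , u) ∷ r} r↭) ⟩
      k K * F ((s , u) ∷ r)             ∎

  evalF-IS : ∀ {c w Y l} → AllW (BottomsOf (c ∷ w) Y) l → evalF (IS l) x ≡ inv (S (c ∷ w) + S Y) * evalF l x
  evalF-IS {c} {w} {Y} = evalF-shift (+ 1) inv powNeg-suc {c} {w} {Y}

  evalF-JS : ∀ {c w Y l} → AllW (BottomsOf (c ∷ w) Y) l → evalF (JS l) x ≡ (S (c ∷ w) + S Y) * evalF l x
  evalF-JS {c} {w} {Y} = evalF-shift ℤ.-1ℤ id powNeg-pred {c} {w} {Y}

  evalF-rule-iii : ∀ {a u w b v y l₁ l₂}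
    → AllW (BottomsOf ((+ suc a , u) ∷ w) ((+ b , v) ∷ y)) l₁
    → AllW (BottomsOf ((+ a , u) ∷ w) ((+ suc b , v) ∷ y)) l₂
    → evalF l₁ x ≡ F ((+ suc a , u) ∷ w) * F ((+ b , v) ∷ y)
    → evalF l₂ x ≡ F ((+ a , u) ∷ w) * F ((+ suc b , v) ∷ y)
    → evalF (IS l₁ ⊕ IS l₂) x ≡ F ((+ suc a , u) ∷ w) * F ((+ suc b , v) ∷ y)
  evalF-rule-iii {a} {u} {w} {b} {v} {y} {l₁} {l₂} p₁ p₂ e₁ e₂ = begin
    evalF (IS l₁ ⊕ IS l₂) x             ≡⟨ linExt-++ F (IS l₁) (IS l₂) ⟩
    evalF (IS l₁) x + evalF (IS l₂) x    ≡⟨ cong₂ _+_ (evalF-IS {(+ suc a , u)} {w} {Y′} p₁)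
                                                      (evalF-IS {(+ a , u)} {w} {Y} p₂) ⟩
    R * evalF l₁ x + R * evalF l₂ x      ≡⟨ cong₂ (λ p q → R * p + R * q) e₁ e₂ ⟩
    R * (F X * F Y′) + R * (F X′ * F Y)  ≡⟨ partial-fractions R P Q (powℕ P a) (F w) (powℕ Q b) (F y)
                                              (inv-+ (S≢0 (+ 0 , u) w) (S≢0 (+ 0 , v) y) (S+S≢0 (+ 0 , u) w Y)) ⟩
    F X * F Y                            ∎
    where
    open ≡-Reasoning
    X = (+ suc a , u) ∷ w
    X′ = (+ a , u) ∷ w
    Y = (+ suc b , v) ∷ y
    Y′ = (+ b , v) ∷ y
    R = inv (S X + S Y)
    P = inv (S X)
    Q = inv (S Y)

  evalF-rule-iv : ∀ {a u w n v y l₁ l₂}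
    → AllW (BottomsOf ((+ suc a , u) ∷ w) ((ℤ.suc -[1+ n ] , v) ∷ y)) l₁
    → evalF l₁ x ≡ F ((+ suc a , u) ∷ w) * F ((ℤ.suc -[1+ n ] , v) ∷ y)
    → evalF l₂ x ≡ F ((+ a , u) ∷ w) * F ((ℤ.suc -[1+ n ] , v) ∷ y)
    → evalF (JS l₁ ⊖ l₂) x ≡ F ((+ suc a , u) ∷ w) * F ((-[1+ n ] , v) ∷ y)
  evalF-rule-iv {a} {u} {w} {n} {v} {y} {l₁} {l₂} p₁ e₁ e₂ = begin
    evalF (JS l₁ ⊖ l₂) x                      ≡⟨ linExt-⊖ F (JS l₁) l₂ ⟩
    evalF (JS l₁) x - evalF l₂ x               ≡⟨ cong (_- evalF l₂ x)
                                                       (evalF-JS {(+ suc a , u)} {w} {Y′} p₁) ⟩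
    (S X + S Y) * evalF l₁ x - evalF l₂ x      ≡⟨ cong₂ (λ p q → (S X + S Y) * p - q) e₁ e₂ ⟩
    (S X + S Y) * (F X * F Y′) - F X′ * F Y′   ≡⟨ lower-and-raise (S X) (S Y) (inv (S X)) (powℕ (inv (S X)) a)
                                                    (F w) (F Y′) (inv-inverseˡ (S≢0 (+ 0 , u) w)) ⟩
    F X * (S Y * F Y′)                         ≡⟨ cong (F X *_) (sym (frac-head {ℤ.suc -[1+ n ]} { -[1+ n ]} {v} {y}
                                                                      (S Y) (powNeg-neg (S Y) n))) ⟩
    F X * F Y                                  ∎
    where
    open ≡-Reasoning
    X = (+ suc a , u) ∷ w
    X′ = (+ a , u) ∷ w
    Y = (-[1+ n ] , v) ∷ y
    Y′ = (ℤ.suc -[1+ n ] , v) ∷ y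

  evalF-rule-v : ∀ {n u w t v y l₁ l₂}
    → AllW (BottomsOf ((ℤ.suc -[1+ n ] , u) ∷ w) ((t , v) ∷ y)) l₁
    → evalF l₁ x ≡ F ((ℤ.suc -[1+ n ] , u) ∷ w) * F ((t , v) ∷ y)
    → evalF l₂ x ≡ F ((ℤ.suc -[1+ n ] , u) ∷ w) * F ((t ℤ.- + 1 , v) ∷ y)
    → evalF (JS l₁ ⊖ l₂) x ≡ F ((-[1+ n ] , u) ∷ w) * F ((t , v) ∷ y)
  evalF-rule-v {n} {u} {w} {t} {v} {y} {l₁} {l₂} p₁ e₁ e₂ = begin
    evalF (JS l₁ ⊖ l₂) x                             ≡⟨ linExt-⊖ F (JS l₁) l₂ ⟩
    evalF (JS l₁) x - evalF l₂ x                      ≡⟨ cong (_- evalF l₂ x)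
                                                           (evalF-JS {(ℤ.suc -[1+ n ] , u)} {w} {Y} p₁) ⟩
    (S X + S Y) * evalF l₁ x - evalF l₂ x             ≡⟨ cong₂ (λ p q → (S X + S Y) * p - q) e₁ e₂ ⟩
    (S X + S Y) * (F X′ * F Y) - F X′ * F Y″          ≡⟨ cong (λ q → (S X + S Y) * (F X′ * F Y) - F X′ * q)
                                                           (frac-head {t} {t ℤ.- + 1} {v} {y}
                                                              (S Y) (powNeg-pred (S≢0 (t , v) y) t)) ⟩
    (S X + S Y) * (F X′ * F Y) - F X′ * (S Y * F Y)   ≡⟨ regroup (S X) (S Y) (F X′) (F Y) ⟩
    (S X * F X′) * F Y                                ≡⟨ cong (_* F Y) (sym (frac-head {ℤ.suc -[1+ n ]} { -[1+ n ]}
                                                           {u} {w} (S X) (powNeg-neg (S X) n))) ⟩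
    F X * F Y                                         ∎
    where
    open ≡-Reasoning
    X = (-[1+ n ] , u) ∷ w
    X′ = (ℤ.suc -[1+ n ] , u) ∷ w
    Y = (t , v) ∷ y
    Y″ = (t ℤ.- + 1 , v) ∷ y
    regroup : ∀ p q f g → (p + q) * (f * g) - f * (q * g) ≡ (p * f) * g
    regroup = RingSolver.solve-∀ ℚ-ring

  evaluation-induction : ShuffleInduction (λ X Y l → AllW (BottomsOf X Y) l × evalF l x ≡ F X * F Y)
  evaluation-induction = record
    { unitˡ    = λ {Y} → B.unitˡ {Y} , trans (evalF-η Y) (sym (ℚP.*-identityˡ (F Y)))
    ; unitʳ    = λ {c} {w} → B.unitʳ {c} {w} , trans (evalF-η (c ∷ w)) (sym (ℚP.*-identityʳ (F (c ∷ w))))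
    ; rule-i   = λ {u} {w} {Y} {l} (p , e) → B.rule-i {u} {w} {Y} p ,
        trans (evalF-pre-zero u l) (trans (cong (1ℚ *_) e) (sym (ℚP.*-assoc 1ℚ (F w) (F Y))))
    ; rule-ii  = λ {X} {v} {y} {l} (p , e) → B.rule-ii {X} {v} {y} p ,
        trans (evalF-pre-zero v l) (trans (cong (1ℚ *_) e) (unit-inside (F X) (F y)))
    ; rule-iii = λ {a} {u} {w} {b} {v} {y} (p₁ , e₁) (p₂ , e₂) →
        B.rule-iii {a} {u} {w} {b} {v} {y} p₁ p₂ , evalF-rule-iii {a} {u} {w} {b} {v} {y} p₁ p₂ e₁ e₂
    ; rule-iv  = λ {a} {u} {w} {n} {v} {y} (p₁ , e₁) (p₂ , e₂) →
        B.rule-iv {a} {u} {w} {n} {v} {y} p₁ p₂ , evalF-rule-iv {a} {u} {w} {n} {v} {y} p₁ e₁ e₂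
    ; rule-v   = λ {n} {u} {w} {t} {v} {y} (p₁ , e₁) (p₂ , e₂) →
        B.rule-v {n} {u} {w} {t} {v} {y} p₁ p₂ , evalF-rule-v {n} {u} {w} {t} {v} {y} p₁ e₁ e₂
    }
    where
    module B = ShuffleInduction bottoms-induction
    unit-inside : ∀ f g → 1ℚ * (f * g) ≡ f * (1ℚ * g)
    unit-inside = RingSolver.solve-∀ ℚ-ring

  evalF-⧢ : ∀ X Y → evalF (X ⧢ Y) x ≡ F X * F Y
  evalF-⧢ X Y = proj₂ (⧢-induction evaluation-induction X Y)

  evalF-⧢ᴸ : ∀ a b → evalF (a ⧢ᴸ b) x ≡ evalF a x * evalF b x
  evalF-⧢ᴸ a b = begin
    evalF (a ⧢ᴸ b) x                                   ≡⟨ linExt-⧢ᴸ F a b ⟩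
    linExt (λ X → linExt (λ Y → evalF (X ⧢ Y) x) b) a  ≡⟨ linExt-cong-∀ (λ X → linExt-cong-∀ (evalF-⧢ X) b) a ⟩
    linExt (λ X → linExt (λ Y → F X * F Y) b) a        ≡⟨ linExt-cong-∀ (λ X → linExt-*ˡ (F X) F b) a ⟩
    linExt (λ X → F X * evalF b x) a                   ≡⟨ linExt-*ʳ (evalF b x) F a ⟩
    evalF a x * evalF b x                              ∎
    where open ≡-Reasoning

rename : (ℕ → ℕ) → Word → Word
rename ρ = map (λ c → proj₁ c , ρ (proj₂ c))

renameL : (ℕ → ℕ) → LC → LC
renameL ρ = mapW (rename ρ)

module _ (ρ : ℕ → ℕ) where

  bottoms-rename : ∀ w → bottoms (rename ρ w) ≡ map ρ (bottoms w)
  bottoms-rename [] = refl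
  bottoms-rename ((_ , u) ∷ w) = cong (ρ u ∷_) (bottoms-rename w)

  tops-rename : ∀ w → tops (rename ρ w) ≡ tops w
  tops-rename [] = refl
  tops-rename ((s , _) ∷ w) = cong (s ∷_) (tops-rename w)

  sumVars-rename : ∀ x w → sumVars x (rename ρ w) ≡ sumVars (x ∘ ρ) w
  sumVars-rename x [] = refl
  sumVars-rename x ((_ , u) ∷ w) = cong (_+_ (x (ρ u))) (sumVars-rename x w)

  frac-rename : ∀ x w → frac (rename ρ w) x ≡ frac w (x ∘ ρ)
  frac-rename x [] = refl
  frac-rename x ((s , u) ∷ w) =
    cong₂ (λ q f → powNeg (x (ρ u) + q) s * f) (sumVars-rename x w) (frac-rename x w)

  evalF-renameL : ∀ x a → evalF (renameL ρ a) x ≡ evalF a (x ∘ ρ)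
  evalF-renameL x a = trans (linExt-mapW (λ w → frac w x) (rename ρ) a) (linExt-cong-∀ (frac-rename x) a)

  module _ (ρ-injective : ∀ {i j} → ρ i ≡ ρ j → i ≡ j)
           (ρ-positive : ∀ {i} → 1 ℕ.≤ i → 1 ℕ.≤ ρ i) where

    Chen-rename : ∀ {w} → Chen w → Chen (rename ρ w)
    Chen-rename {w} (uw , pw) =
      subst Unique (sym (bottoms-rename w)) (UniqueP.map⁺ ρ-injective uw) ,
      subst (All (1 ℕ.≤_)) (sym (bottoms-rename w)) (AllP.map⁺ (All.map ρ-positive pw))

    Conv-rename : ∀ {w} → Conv w → Conv (rename ρ w)
    Conv-rename (inj₁ refl) = inj₁ refl
    Conv-rename {w} (inj₂ (ch , ct)) = inj₂ (Chen-rename ch , ct′)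
      where ct′ : ConvTops (rename ρ w)
            ct′ j 1≤j j≤ = subst (λ ts → + j ℤ.< sumℤ (take j ts)) (sym (tops-rename w))
                                 (ct j 1≤j (subst (j ℕ.≤_) (LP.length-map _ w) j≤))

    InSpan-renameL : ∀ {a} → InSpan Conv a → InSpan Conv (renameL ρ a)
    InSpan-renameL {a} ca w ne with mapW-support (rename ρ) a w ne
    ... | v , cv , refl = Conv-rename (ca v cv)

⊤W-apart : ∀ {ρ σ v v′} → (∀ i j → ρ i ≢ σ j) → Conv (rename ρ v) → Conv (rename σ v′)
         → rename ρ v ⊤W rename σ v′
⊤W-apart _ (inj₁ e) _ = inj₁ e
⊤W-apart _ (inj₂ _) (inj₁ e′) = inj₂ (inj₁ e′)
⊤W-apart {ρ} {σ} {v} {v′} ρ#σ (inj₂ (ch , _)) (inj₂ (ch′ , _)) = inj₂ (inj₂ (ch , ch′ , disjoint))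
  where
  disjoint : DisjointB (rename ρ v) (rename σ v′)
  disjoint i i∈ i∈′ with MemP.∈-map⁻ ρ (subst (i ∈_) (bottoms-rename ρ v) i∈)
                       | MemP.∈-map⁻ σ (subst (i ∈_) (bottoms-rename σ v′) i∈′)
  ... | k , _ , refl | m , _ , ρk≡σm = ρ#σ k m ρk≡σm

⊤L-apart : ∀ {ρ σ a b} → (∀ i j → ρ i ≢ σ j) → InSpan Conv (renameL ρ a) → InSpan Conv (renameL σ b)
         → renameL ρ a ⊤L renameL σ b
⊤L-apart {ρ} {σ} {a} {b} ρ#σ ca cb w w′ ne ne′
  with mapW-support (rename ρ) a w ne | mapW-support (rename σ) b w′ ne′
... | _ , _ , refl | _ , _ , refl = ⊤W-apart ρ#σ (ca _ ne) (cb _ ne′)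

evalF-renameL-fixing : ∀ {S ρ} a → (∀ {i} → i ∈ S → ρ i ≡ i) → DependsOnly (evalF a) S
                     → ∀ x → Pos x → evalF (renameL ρ a) x ≡ evalF a x
evalF-renameL-fixing {S} {ρ} a fixes dep x x>0 =
  trans (evalF-renameL ρ x a) (dep (x ∘ ρ) x (x>0 ∘ ρ) x>0 (λ _ i∈S → cong x (fixes i∈S)))

fixing : List ℕ → (ℕ → ℕ) → ℕ → ℕ
fixing S f i = if does (i ∈? S) then i else f i

module _ {S : List ℕ} {f : ℕ → ℕ} where

  fixing-∈ : ∀ {i} → i ∈ S → fixing S f i ≡ i
  fixing-∈ {i} i∈S with i ∈? S
  ... | yes _ = refl
  ... | no i∉S = ⊥-elim (i∉S i∈S)

  fixing-injective : (∀ {i j} → f i ≡ f j → i ≡ j) → (∀ i → f i ∉ S)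
                   → ∀ {i j} → fixing S f i ≡ fixing S f j → i ≡ j
  fixing-injective f-inj f∉S {i} {j} e with i ∈? S | j ∈? S
  ... | yes _ | yes _ = e
  ... | yes i∈S | no _ = ⊥-elim (f∉S j (subst (_∈ S) e i∈S))
  ... | no _ | yes j∈S = ⊥-elim (f∉S i (subst (_∈ S) (sym e) j∈S))
  ... | no _ | no _ = f-inj e

  fixing-positive : (∀ i → 1 ℕ.≤ f i) → ∀ {i} → 1 ℕ.≤ i → 1 ℕ.≤ fixing S f i
  fixing-positive f-pos {i} 1≤i with i ∈? S
  ... | yes _ = 1≤i
  ... | no _ = f-pos i

fixing-apart : ∀ {S T f g} → DisjointL S T → (∀ i → f i ∉ T) → (∀ j → g j ∉ S) → (∀ i j → f i ≢ g j)
             → ∀ i j → fixing S f i ≢ fixing T g j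
fixing-apart {S} {T} S#T f∉T g∉S f#g i j e with i ∈? S | j ∈? T
... | yes i∈S | yes j∈T = S#T i i∈S (subst (_∈ T) (sym e) j∈T)
... | yes i∈S | no _ = g∉S j (subst (_∈ S) e i∈S)
... | no _ | yes j∈T = f∉T i (subst (_∈ T) (sym e) j∈T)
... | no _ | no _ = f#g i j e

∈⇒≤sum : ∀ {k ks} → k ∈ ks → k ℕ.≤ sum ks
∈⇒≤sum {ks = k ∷ ks} (here refl) = ℕP.m≤m+n k (sum ks)
∈⇒≤sum {ks = k ∷ ks} (there k∈) = ℕP.≤-trans (∈⇒≤sum k∈) (ℕP.m≤n+m (sum ks) k)

-- Labels outside V (resp. W) are sent above V ++ W, to even (resp. odd) offsets, so that
-- the images of ρ and σ are disjoint.
module Separation (V W : List ℕ) (V#W : DisjointL V W) where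

  N : ℕ
  N = suc (sum (V ++ W))

  even odd : ℕ → ℕ
  even i = N ℕ.+ 2 ℕ.* i
  odd i = N ℕ.+ suc (2 ℕ.* i)

  ρ σ : ℕ → ℕ
  ρ = fixing V even
  σ = fixing W odd

  fresh : ∀ {k} → N ℕ.≤ k → k ∉ V ++ W
  fresh N≤k k∈ = ℕP.<-irrefl refl (ℕP.<-≤-trans (ℕ.s≤s (∈⇒≤sum k∈)) N≤k)

  even∉V : ∀ i → even i ∉ V
  even∉V i = fresh (ℕP.m≤m+n N _) ∘ MemP.∈-++⁺ˡ
  even∉W : ∀ i → even i ∉ W
  even∉W i = fresh (ℕP.m≤m+n N _) ∘ MemP.∈-++⁺ʳ V
  odd∉V : ∀ i → odd i ∉ V
  odd∉V i = fresh (ℕP.m≤m+n N _) ∘ MemP.∈-++⁺ˡ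
  odd∉W : ∀ i → odd i ∉ W
  odd∉W i = fresh (ℕP.m≤m+n N _) ∘ MemP.∈-++⁺ʳ V

  even-injective : ∀ {i j} → even i ≡ even j → i ≡ j
  even-injective {i} {j} e = ℕP.*-cancelˡ-≡ i j 2 (ℕP.+-cancelˡ-≡ N _ _ e)

  odd-injective : ∀ {i j} → odd i ≡ odd j → i ≡ j
  odd-injective {i} {j} e = ℕP.*-cancelˡ-≡ i j 2 (ℕP.suc-injective (ℕP.+-cancelˡ-≡ N _ _ e))

  ρ#σ : ∀ i j → ρ i ≢ σ j
  ρ#σ = fixing-apart V#W even∉W odd∉V (λ i j e → ℕP.even≢odd i j (ℕP.+-cancelˡ-≡ N _ _ e))

  ρ-injective : ∀ {i j} → ρ i ≡ ρ j → i ≡ j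
  ρ-injective = fixing-injective even-injective even∉V

  σ-injective : ∀ {i j} → σ i ≡ σ j → i ≡ j
  σ-injective = fixing-injective odd-injective odd∉W

  ρ-positive : ∀ {i} → 1 ℕ.≤ i → 1 ℕ.≤ ρ i
  ρ-positive = fixing-positive {V} {even} (λ _ → ℕ.s≤s ℕ.z≤n)

  σ-positive : ∀ {i} → 1 ℕ.≤ i → 1 ℕ.≤ σ i
  σ-positive = fixing-positive {W} {odd} (λ _ → ℕ.s≤s ℕ.z≤n)

product-in-disjoint-variables : ∀ a b V W → InSpan Conv a → InSpan Conv b
  → DependsOnly (evalF a) V → DependsOnly (evalF b) W → DisjointL V W
  → Σ LC (λ c → InSpan Conv c × (∀ x → Pos x → evalF a x * evalF b x ≡ evalF c x))
product-in-disjoint-variables a b V W ca cb da db V#W =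
  a′ ⧢ᴸ b′ , ⧢ᴸ-preserves-Conv a′ b′ ca′ cb′ (⊤L-apart {ρ} {σ} {a} {b} ρ#σ ca′ cb′) , value
  where
  open Separation V W V#W
  a′ = renameL ρ a
  b′ = renameL σ b
  ca′ : InSpan Conv a′
  ca′ = InSpan-renameL ρ ρ-injective ρ-positive {a} ca
  cb′ : InSpan Conv b′
  cb′ = InSpan-renameL σ σ-injective σ-positive {b} cb
  value : ∀ x → Pos x → evalF a x * evalF b x ≡ evalF (a′ ⧢ᴸ b′) x
  value x x>0 = begin
    evalF a x * evalF b x    ≡⟨ sym (cong₂ _*_ (evalF-renameL-fixing a (fixing-∈ {V} {even}) da x x>0)
                                               (evalF-renameL-fixing b (fixing-∈ {W} {odd}) db x x>0)) ⟩
    evalF a′ x * evalF b′ x  ≡⟨ sym (Evaluation.evalF-⧢ᴸ x x>0 a′ b′) ⟩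
    evalF (a′ ⧢ᴸ b′) x       ∎
    where open ≡-Reasoning

proposition4p6 : (∀ (a b : LC) → InSpan Conv a → InSpan Conv b → a ⊤L b → InSpan Conv (a ⧢ᴸ b))
    × (∀ (a b : LC) (V W : List ℕ) → InSpan Conv a → InSpan Conv b
         → DependsOnly (evalF a) V → DependsOnly (evalF b) W → DisjointL V W
         → Σ LC (λ c → InSpan Conv c × (∀ x → Pos x → evalF a x * evalF b x ≡ evalF c x)))
proposition4p6 = ⧢ᴸ-preserves-Conv , product-in-disjoint-variables
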